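{- Let $R$ be a ring with multiplicative identity $1$, and let $(A,C,U)$ be a Frobenius template in $R$ such that $1\in U$. If $(\alpha_1,\dots,\alpha_n)$ is a list of elements of $A$ such that $\mathrm{Frob}(\alpha_1,\dots,\alpha_n)\neq\emptyset$, then $(\alpha_1,\dots,\alpha_n)$ spans unity in $R$, i.e. there exist $\lambda_1,\dots,\lambda_n\in R$ with $1=\lambda_1\alpha_1+\dots+\lambda_n\alpha_n$.
   Context: An additive monoid in a ring $R$ is a subset of $R$ closed under addition and containing $0$. A Frobenius template in $R$ is a triple $(A,C,U)$ where $A$ is a nonempty subset of $R$, $C$ and $U$ are additive monoids in $R$, and for every finite list $(\alpha_1,\dots,\alpha_n)$ of elements of $A$ the set $MN(\alpha_1,\dots,\alpha_n)=\{\sum_{i=1}^n\lambda_i\alpha_i:\lambda_1,\dots,\lambda_n\in C\}$ is a subset of $U$. The Frobenius set of such a list is $\mathrm{Frob}(\alpha_1,\dots,\alpha_n)=\{w\in R: w+U\subseteq MN(\alpha_1,\dots,\alpha_n)\}$, where $w+U=\{w+u:u\in U\}$. -}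

module Defs where

open import Level using (Level; _⊔_; suc)
open import Algebra.Bundles using (Ring)
open import Data.Nat using (ℕ)
open import Data.Fin using (Fin)
open import Data.Product using (Σ; ∃; _×_; _,_)
open import Relation.Unary using (Pred)
import Algebra.Properties.Monoid.Sum as MonoidSum

module _ {c ℓ : Level} (R : Ring c ℓ) where
  open Ring R

  ∑ : {n : ℕ} → (Fin n → Carrier) → Carrier
  ∑ = MonoidSum.sum +-monoid

  IsSubset : Pred Carrier ℓ → Set (c ⊔ ℓ)
  IsSubset S = ∀ {x y} → x ≈ y → S x → S y

  record IsAdditiveMonoid (S : Pred Carrier ℓ) : Set (c ⊔ ℓ) where
    field
      respects : IsSubset S
      has-0    : S 0#
      closed-+ : ∀ {x y} → S x → S y → S (x + y)

  MN : (C : Pred Carrier ℓ) {n : ℕ} → (Fin n → Carrier) → Pred Carrier (c ⊔ ℓ)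
  MN C α x = Σ (Fin _ → Carrier) λ λs → (∀ i → C (λs i)) × (x ≈ ∑ (λ i → λs i * α i))

  record IsFrobeniusTemplate (A C U : Pred Carrier ℓ) : Set (suc (c ⊔ ℓ)) where
    field
      A-subset   : IsSubset A
      A-nonempty : ∃ λ a → A a
      C-monoid   : IsAdditiveMonoid C
      U-monoid   : IsAdditiveMonoid U
      MN⊆U       : ∀ {n : ℕ} (α : Fin n → Carrier) → (∀ i → A (α i)) →
                   ∀ {x} → MN C α x → U x

  Frob : (C U : Pred Carrier ℓ) {n : ℕ} → (Fin n → Carrier) → Pred Carrier (c ⊔ ℓ)
  Frob C U α w = ∀ {u} → U u → MN C α (w + u)

  SpansUnity : {n : ℕ} → (Fin n → Carrier) → Set (c ⊔ ℓ)
  SpansUnity α = Σ (Fin _ → Carrier) λ λs → 1# ≈ ∑ (λ i → λs i * α i)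

{-# OPTIONS --safe #-}
-- Evaluating the Frobenius condition w + U ⊆ MN(α) at u = 1 and at u = 0 writes both
-- w + 1 and w as combinations Σ νᵢ αᵢ and Σ μᵢ αᵢ; subtracting, 1 = Σ (νᵢ - μᵢ) αᵢ.
module Submission where

open import Defs
open import Level using (Level)
open import Algebra.Bundles using (Ring)
open import Data.Nat using (ℕ)
open import Data.Fin using (Fin)
open import Data.Product using (∃; Σ; _,_)
open import Relation.Unary using (Pred)
import Algebra.Properties.Ring as RingProperties
import Algebra.Properties.CommutativeMonoid.Sum as CommutativeMonoidSum
import Relation.Binary.Reasoning.Setoid as SetoidReasoning

module _ {c ℓ : Level} (R : Ring c ℓ) where
  open Ring R
  open RingProperties R using (//-rightDividesˡ)
  open CommutativeMonoidSum +-commutativeMonoid using (∑-distrib-+; sum-cong-≋)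
  open SetoidReasoning setoid

  ∑-*-distribʳ-− : ∀ {n} (ν μ α : Fin n → Carrier) →
    ∑ R (λ i → (ν i - μ i) * α i) + ∑ R (λ i → μ i * α i) ≈ ∑ R (λ i → ν i * α i)
  ∑-*-distribʳ-− ν μ α = begin
    ∑ R (λ i → (ν i - μ i) * α i) + ∑ R (λ i → μ i * α i)
      ≈⟨ sym (∑-distrib-+ (λ i → (ν i - μ i) * α i) (λ i → μ i * α i)) ⟩
    ∑ R (λ i → (ν i - μ i) * α i + μ i * α i)
      ≈⟨ sum-cong-≋ (λ i → trans (sym (distribʳ (α i) (ν i - μ i) (μ i)))
                                 (*-congʳ (//-rightDividesˡ (μ i) (ν i)))) ⟩
    ∑ R (λ i → ν i * α i) ∎

  MN-difference : ∀ (C : Pred Carrier ℓ) {n} (α : Fin n → Carrier) {x y} →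
    MN R C α x → MN R C α y →
    Σ (Fin n → Carrier) λ λs → x ≈ y + ∑ R (λ i → λs i * α i)
  MN-difference C α {x} {y} (ν , _ , x≈∑να) (μ , _ , y≈∑μα) = (λ i → ν i - μ i) , (begin
    x                                                        ≈⟨ x≈∑να ⟩
    ∑ R (λ i → ν i * α i)                                    ≈⟨ sym (∑-*-distribʳ-− ν μ α) ⟩
    ∑ R (λ i → (ν i - μ i) * α i) + ∑ R (λ i → μ i * α i)    ≈⟨ +-comm _ _ ⟩
    ∑ R (λ i → μ i * α i) + ∑ R (λ i → (ν i - μ i) * α i)    ≈⟨ +-congʳ (sym y≈∑μα) ⟩
    y + ∑ R (λ i → (ν i - μ i) * α i)                        ∎)

proposition2p1 : {c ℓ : Level} (R : Ring c ℓ) (A C U : Pred (Ring.Carrier R) ℓ) →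
    IsFrobeniusTemplate R A C U → U (Ring.1# R) →
    {n : ℕ} (α : Fin n → Ring.Carrier R) → (∀ i → A (α i)) →
    ∃ (λ w → Frob R C U α w) →
    SpansUnity R α
proposition2p1 R A C U template U1 α _ (w , w∈Frob) =
  let λs , w+1≈w+0+∑ = MN-difference R C α (w∈Frob U1) (w∈Frob has-0)
  in λs , +-cancelˡ w _ _ (begin
    w + 1#                              ≈⟨ w+1≈w+0+∑ ⟩
    w + 0# + ∑ R (λ i → λs i * α i)     ≈⟨ +-congʳ (+-identityʳ w) ⟩
    w + ∑ R (λ i → λs i * α i)          ∎)
  where
  open Ring R
  open RingProperties R using (+-cancelˡ)
  open SetoidReasoning setoid
  open IsAdditiveMonoid (IsFrobeniusTemplate.U-monoid template) using (has-0)
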